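{- Let $f$ be a block function on $(\omega,<)$, and suppose that $f$ has an infinite weak $f$-coding sequence. Then $f$ has an infinite (strong) $f$-coding sequence.
   Context: A function $f:\omega\to\omega$ is a block function if every $n$ lies in a finite interval $[a,b]$ with $f([a,b])\subseteq[a,b]$ and $f^{ -1}([a,b])\subseteq[a,b]$; the minimal such interval is the $f$-block of $n$. A map $\varphi$ between subsets of $\omega$ preserves $f$ if $\varphi(f(x))=f(\varphi(x))$ for all $x$ in its domain. An $f$-coding sequence consists of intervals $[a_1,b_1],[a_2,b_2],\dots$ of $\omega$ and maps $\varphi_i:[a_i,b_i]\to[a_{i+1},b_{i+1}]$ such that: (1) each interval contains every $f$-block it intersects; (2) each $\varphi_i$ is strictly order-preserving with $\varphi_i(x)\ge x$ for all $x$; (3) each $\varphi_{i+1}\circ\varphi_i$ preserves $f$; (4) $\varphi_1$ does not preserve $f$; (5) $a_{i+1}>b_i$ for all $i$. A weak $f$-coding sequence is one satisfying (1)–(4) but not necessarily (5). -}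

module Defs where

open import Data.Nat using (ℕ; suc; _≤_; _<_)
open import Data.Product using (Σ; _×_; ∃₂)
open import Relation.Binary.PropositionalEquality using (_≡_)
open import Relation.Nullary using (¬_)

_∈[_,_] : ℕ → ℕ → ℕ → Set
x ∈[ a , b ] = a ≤ x × x ≤ b

Closed : (ℕ → ℕ) → ℕ → ℕ → Set
Closed f a b = (∀ x → x ∈[ a , b ] → f x ∈[ a , b ])
             × (∀ x → f x ∈[ a , b ] → x ∈[ a , b ])

BlockFunction : (ℕ → ℕ) → Set
BlockFunction f = ∀ n → ∃₂ λ a b → n ∈[ a , b ] × Closed f a b

IsBlock : (ℕ → ℕ) → ℕ → ℕ → ℕ → Set
IsBlock f n a b = n ∈[ a , b ] × Closed f a b
                × (∀ a' b' → n ∈[ a' , b' ] → Closed f a' b' → a' ≤ a × b ≤ b')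

Preserves : (ℕ → ℕ) → (ℕ → ℕ) → ℕ → ℕ → Set
Preserves f φ a b = ∀ x → x ∈[ a , b ] → φ (f x) ≡ f (φ x)

-- A weak f-coding sequence (indexed from 0): intervals [a i , b i] and maps
-- φ i : [a i , b i] → [a (suc i) , b (suc i)], represented as total functions
-- ℕ → ℕ of which only the restriction to [a i , b i] matters.
record WeakCoding (f : ℕ → ℕ) (a b : ℕ → ℕ) (φ : ℕ → ℕ → ℕ) : Set where
  field
    maps-into   : ∀ i x → x ∈[ a i , b i ] → φ i x ∈[ a (suc i) , b (suc i) ]
    block-cont  : ∀ i x → x ∈[ a i , b i ] → ∀ c d → IsBlock f x c d
                  → a i ≤ c × d ≤ b i
    strict-mono : ∀ i x y → x ∈[ a i , b i ] → y ∈[ a i , b i ] → x < y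
                  → φ i x < φ i y
    inflating   : ∀ i x → x ∈[ a i , b i ] → x ≤ φ i x
    comp-pres   : ∀ i → Preserves f (λ x → φ (suc i) (φ i x)) (a i) (b i)
    first-not   : ¬ Preserves f (φ 0) (a 0) (b 0)

record Coding (f : ℕ → ℕ) (a b : ℕ → ℕ) (φ : ℕ → ℕ → ℕ) : Set where
  field
    weak      : WeakCoding f a b φ
    separated : ∀ i → b i < a (suc i)

{-# OPTIONS --safe #-}
-- Write Φ i k = φ (k + i − 1) ∘ ⋯ ∘ φ i. Composites of even length commute with f, while the odd
-- composites Φ 0 (2j+1) fail to commute at any point x₀ where φ 0 does. So at every double step x₀
-- or f x₀ moves strictly, whence Φ 0 (2k) x₀ + Φ 0 (2k) (f x₀) ≥ k; since a closed prefix [0, D] is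
-- completely f-invariant and Φ 0 (2k) (f x₀) = f (Φ 0 (2k) x₀), the even iterates of x₀ leave it.
--
-- The strong sequence jumps along odd lengths. From an interval [lo, hi] whose left end escapes, jump
-- 2j+1 levels so that the image of lo lies beyond a closed prefix containing hi, and take the closed
-- hull of the image. If g is monotone and commutes with f, the part of a closed hull that g sends
-- beyond a closed prefix is a closed final segment of the hull, hence the whole hull; so (with g = id)
-- the new interval lies beyond hi and (with g an even composite) its left end escapes again.
-- Consecutive jumps add up to an even length, and the first jump is odd.
module Submission where

open import Defs
open import Data.Nat using (ℕ; zero; suc; _+_; _∸_; _⊓_; _≤_; _<_; _≤?_; _<?_; _≟_; z≤n; s≤s)
open import Data.Nat.Properties
open import Data.Nat.Induction using (<-rec)
open import Data.Product using (Σ; ∃; ∃₂; _×_; _,_; proj₁; proj₂)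
import Data.Product as Product
open import Data.Sum using (_⊎_; inj₁; inj₂)
import Data.Sum as Sum
open import Function using (id; _∘_)
open import Relation.Nullary using (¬_; Dec; yes; no; contradiction)
open import Relation.Nullary.Decidable using (_×-dec_; _→-dec_; ¬?; decidable-stable)
open import Relation.Unary using (Decidable; _⊆_; _≐_; _∪_; _∩_)
open import Relation.Binary.PropositionalEquality
  using (_≡_; _≢_; refl; sym; trans; cong; cong₂; subst; module ≡-Reasoning)

∈-widen : ∀ {x a b a′ b′} → a′ ≤ a → b ≤ b′ → x ∈[ a , b ] → x ∈[ a′ , b′ ]
∈-widen a′≤a b≤b′ (a≤x , x≤b) = ≤-trans a′≤a a≤x , ≤-trans x≤b b≤b′

module _ {P : ℕ → Set} (P? : Decidable P) where

  least : ∀ {w} → P w → ∃ λ t → t ≤ w × P t × (∀ {x} → P x → t ≤ x)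
  least {w} = <-rec Least search w
    where
    Least : ℕ → Set
    Least w = P w → ∃ λ t → t ≤ w × P t × (∀ {x} → P x → t ≤ x)
    search : ∀ w → (∀ {y} → y < w → Least y) → Least w
    search w rec pw with anyUpTo? P? w
    ... | no ∄ = w , ≤-refl , pw , λ px → ≮⇒≥ λ x<w → ∄ (_ , x<w , px)
    ... | yes (y , y<w , py) with rec y<w py
    ...   | t , t≤y , pt , t-least = t , ≤-trans t≤y (<⇒≤ y<w) , pt , t-least

  greatest : ∀ {w u} → w ≤ u → P w → ∃ λ t → t ≤ u × P t × (∀ {x} → x ≤ u → P x → x ≤ t)
  greatest {u = u} w≤u pw with P? u
  ... | yes pu = u , ≤-refl , pu , λ x≤u _ → x≤u
  ... | no ¬pu with m≤n⇒m<n∨m≡n w≤u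
  ...   | inj₂ refl = contradiction pw ¬pu
  ...   | inj₁ (s≤s w≤u′) with greatest w≤u′ pw
  ...     | t , t≤u′ , pt , t-greatest =
    t , m≤n⇒m≤1+n t≤u′ , pt ,
    λ x≤u px → t-greatest (≤-pred (≤∧≢⇒< x≤u λ { refl → ¬pu px })) px

  upward-closed⇒interval : ∀ {u d} → (∀ {x} → P x → x ≤ d) → (∀ {x y} → P x → x ≤ y → y ≤ d → P y)
                         → P u → ∃ λ t → t ≤ u × P ≐ (_∈[ t , d ])
  upward-closed⇒interval bounded upward pu with least pu
  ... | t , t≤u , pt , t-least =
    t , t≤u , (λ px → t-least px , bounded px) , λ (t≤x , x≤d) → upward pt t≤x x≤d

increasing⇒n≤ : ∀ {g : ℕ → ℕ} → (∀ k → g k < g (suc k)) → ∀ k → k ≤ g k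
increasing⇒n≤ increasing zero    = z≤n
increasing⇒n≤ increasing (suc k) = ≤-<-trans (increasing⇒n≤ increasing k) (increasing k)

data Even : ℕ → Set where
  zero : Even zero
  2+_  : ∀ {n} → Even n → Even (suc (suc n))

even-+ : ∀ {m n} → Even m → Even n → Even (m + n)
even-+ zero     en = en
even-+ (2+ em) en = 2+ even-+ em en

even-double : ∀ k → Even (k + k)
even-double zero = zero
even-double (suc k) rewrite +-suc k k = 2+ even-double k

even-suc+suc : ∀ {m n} → Even m → Even n → Even (suc m + suc n)
even-suc+suc {m} {n} em en rewrite +-suc m n = 2+ even-+ em en

-- Closed f c d unfolds to CompletelyInvariant f (_∈[ c , d ]).
CompletelyInvariant : (ℕ → ℕ) → (ℕ → Set) → Set
CompletelyInvariant f P = (∀ x → P x → P (f x)) × (∀ x → P (f x) → P x)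

record ClosedHull (f : ℕ → ℕ) (u v : ℕ) : Set where
  field
    lo hi   : ℕ
    closed  : Closed f lo hi
    lo≤u    : lo ≤ u
    v≤hi    : v ≤ hi
    minimal : ∀ {c d} → c ≤ u → v ≤ d → Closed f c d → c ≤ lo × hi ≤ d

module _ {f : ℕ → ℕ} where

  invariant-≐ : ∀ {P Q} → P ≐ Q → CompletelyInvariant f P → CompletelyInvariant f Q
  invariant-≐ (P⊆Q , Q⊆P) (fw , bw) = (λ x → P⊆Q ∘ fw x ∘ Q⊆P) , (λ x → P⊆Q ∘ bw x ∘ Q⊆P)

  invariant-∩ : ∀ {P Q} → CompletelyInvariant f P → CompletelyInvariant f Q
              → CompletelyInvariant f (P ∩ Q)
  invariant-∩ (fwP , bwP) (fwQ , bwQ) =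
    (λ x → Product.map (fwP x) (fwQ x)) , (λ x → Product.map (bwP x) (bwQ x))

  invariant-∪ : ∀ {P Q} → CompletelyInvariant f P → CompletelyInvariant f Q
              → CompletelyInvariant f (P ∪ Q)
  invariant-∪ (fwP , bwP) (fwQ , bwQ) =
    (λ x → Sum.map (fwP x) (fwQ x)) , (λ x → Sum.map (bwP x) (bwQ x))

  invariant-preimage : ∀ {P Q g} → CompletelyInvariant f P → (∀ {x} → P x → g (f x) ≡ f (g x))
                     → CompletelyInvariant f Q → CompletelyInvariant f (P ∩ (Q ∘ g))
  invariant-preimage {Q = Q} {g} (fwP , bwP) comm (fwQ , bwQ) =
    (λ x (px , qgx) → fwP x px , subst Q (sym (comm px)) (fwQ (g x) qgx)) ,
    (λ x (pfx , qgfx) → bwP x pfx , bwQ (g x) (subst Q (comm (bwP x pfx)) qgfx))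

  above-invariant : ∀ {D} → Closed f 0 D → CompletelyInvariant f (D <_)
  above-invariant (fw , bw) =
    (λ x D<x → ≰⇒> λ fx≤D → <⇒≱ D<x (proj₂ (bw x (z≤n , fx≤D)))) ,
    (λ x D<fx → ≰⇒> λ x≤D → <⇒≱ D<fx (proj₂ (fw x (z≤n , x≤D))))

  closed-∩ : ∀ {c₁ d₁ c₂ d₂} → c₁ ≤ c₂ → Closed f c₁ d₁ → Closed f c₂ d₂ → Closed f c₂ (d₁ ⊓ d₂)
  closed-∩ {c₁} {d₁} {c₂} {d₂} c₁≤c₂ cl₁ cl₂ = invariant-≐ (to , from) (invariant-∩ cl₁ cl₂)
    where
    to : (_∈[ c₁ , d₁ ] ∩ _∈[ c₂ , d₂ ]) ⊆ _∈[ c₂ , d₁ ⊓ d₂ ]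
    to ((_ , x≤d₁) , (c₂≤x , x≤d₂)) = c₂≤x , ⊓-glb x≤d₁ x≤d₂
    from : _∈[ c₂ , d₁ ⊓ d₂ ] ⊆ (_∈[ c₁ , d₁ ] ∩ _∈[ c₂ , d₂ ])
    from (c₂≤x , x≤d) =
      (≤-trans c₁≤c₂ c₂≤x , ≤-trans x≤d (m⊓n≤m d₁ d₂)) , (c₂≤x , ≤-trans x≤d (m⊓n≤n d₁ d₂))

  closed-∪ : ∀ {D A B} → A ≤ suc D → D ≤ B → Closed f 0 D → Closed f A B → Closed f 0 B
  closed-∪ {D} {A} {B} A≤1+D D≤B cD cAB = invariant-≐ (to , from) (invariant-∪ cD cAB)
    where
    to : (_∈[ 0 , D ] ∪ _∈[ A , B ]) ⊆ _∈[ 0 , B ]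
    to (inj₁ (_ , x≤D)) = z≤n , ≤-trans x≤D D≤B
    to (inj₂ (_ , x≤B)) = z≤n , x≤B
    from : _∈[ 0 , B ] ⊆ (_∈[ 0 , D ] ∪ _∈[ A , B ])
    from {x} (_ , x≤B) with x ≤? D
    ... | yes x≤D = inj₁ (z≤n , x≤D)
    ... | no x≰D  = inj₂ (≤-trans A≤1+D (≰⇒> x≰D) , x≤B)

  closed-prefix : BlockFunction f → ∀ y → ∃ λ D → y ≤ D × Closed f 0 D
  closed-prefix bf zero with bf zero
  ... | _ , B , (z≤n , _) , cB = B , z≤n , cB
  closed-prefix bf (suc y) with closed-prefix bf y | bf (suc y)
  ... | D , y≤D , cD | A , B , (A≤1+y , 1+y≤B) , cAB with ≤-total D B
  ...   | inj₁ D≤B = B , 1+y≤B , closed-∪ (≤-trans A≤1+y (s≤s y≤D)) D≤B cD cAB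
  ...   | inj₂ B≤D = D , ≤-trans 1+y≤B B≤D , cD

  invariant? : ∀ {P D} → Closed f 0 D → Decidable P → (∀ {x} → P x → x ≤ D)
             → Dec (CompletelyInvariant f P)
  invariant? {P} {D} (_ , bw) P? bounded
    with allUpTo? (λ x → (P? x →-dec P? (f x)) ×-dec (P? (f x) →-dec P? x)) (suc D)
  ... | no ¬both = no λ (fw , bw) → ¬both λ _ → fw _ , bw _
  ... | yes both = yes
    ( (λ x px → proj₁ (both (s≤s (bounded px))) px)
    , (λ x pfx → proj₂ (both (s≤s (proj₂ (bw x (z≤n , bounded pfx))))) pfx))

  closed? : BlockFunction f → ∀ c d → Dec (Closed f c d)
  closed? bf c d with closed-prefix bf d
  ... | D , d≤D , cD = invariant? cD (λ x → (c ≤? x) ×-dec (x ≤? d)) λ (_ , x≤d) → ≤-trans x≤d d≤D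

  closedHull : BlockFunction f → ∀ u v → ClosedHull f u v
  closedHull bf u v with closed-prefix bf v
  ... | D , v≤D , cD
    with greatest (λ c → anyUpTo? (λ d → (v ≤? d) ×-dec closed? bf c d) (suc D))
                  z≤n (D , ≤-refl , v≤D , cD)
  ... | L , L≤u , (d , _ , v≤d , cLd) , L-greatest
    with least (λ d → (v ≤? d) ×-dec closed? bf L d) (v≤d , cLd)
  ... | U , _ , (v≤U , cLU) , U-least = record
    { lo = L ; hi = U ; closed = cLU ; lo≤u = L≤u ; v≤hi = v≤U
    ; minimal = λ {c} {d} c≤u v≤d cl →
        let c≤L = L-greatest c≤u (D ⊓ d , s≤s (m⊓n≤m D d) , ⊓-glb v≤D v≤d , closed-∩ z≤n cD cl)
        in c≤L , ≤-trans (U-least (⊓-glb v≤d v≤U , closed-∩ c≤L cl cLU)) (m⊓n≤m d U)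
    }

  block : BlockFunction f → ∀ x → ∃₂ λ c d → IsBlock f x c d
  block bf x = lo , hi , (lo≤u , v≤hi) , closed , λ _ _ (c≤x , x≤d) → minimal c≤x x≤d
    where open ClosedHull (closedHull bf x x)

  contains-blocks⇒closed : ∀ {A B} → BlockFunction f
    → (∀ x → x ∈[ A , B ] → ∀ c d → IsBlock f x c d → A ≤ c × d ≤ B) → Closed f A B
  contains-blocks⇒closed {A} {B} bf contains =
    (λ x x∈ → let (_ , _ , x∈cd , (fw , _) , A≤c , d≤B) = block-within x∈
              in ∈-widen A≤c d≤B (fw x x∈cd)) ,
    (λ x fx∈ → let (_ , _ , fx∈cd , (_ , bw) , A≤c , d≤B) = block-within fx∈
               in ∈-widen A≤c d≤B (bw x fx∈cd))
    where
    block-within : ∀ {x} → x ∈[ A , B ] → ∃₂ λ c d → x ∈[ c , d ] × Closed f c d × A ≤ c × d ≤ B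
    block-within {x} x∈ =
      let (c , d , blk) = block bf x in c , d , proj₁ blk , proj₁ (proj₂ blk) , contains x x∈ c d blk

  hull-above : ∀ {u v D} (g : ℕ → ℕ) (H : ClosedHull f u v) → let open ClosedHull H in u ≤ v
    → (∀ {x y} → x ∈[ lo , hi ] → y ∈[ lo , hi ] → x ≤ y → g x ≤ g y)
    → (∀ {x} → x ∈[ lo , hi ] → g (f x) ≡ f (g x))
    → Closed f 0 D → D < g u → D < g lo
  hull-above {u} {v} {D} g H u≤v mono comm cD D<gu =
    let (t , t≤u , P≐[t,hi]) = upward-closed⇒interval P? (proj₂ ∘ proj₁) upward (u∈ , D<gu)
        [t,hi]-closed = invariant-≐ P≐[t,hi] (invariant-preimage closed comm (above-invariant cD))
        t≤lo = proj₁ (minimal t≤u v≤hi [t,hi]-closed)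
    in proj₂ (proj₂ P≐[t,hi] (t≤lo , ≤-trans lo≤u (proj₂ u∈)))
    where
    open ClosedHull H
    u∈ : u ∈[ lo , hi ]
    u∈ = lo≤u , ≤-trans u≤v v≤hi
    P : ℕ → Set
    P x = x ∈[ lo , hi ] × D < g x
    P? : Decidable P
    P? x = ((lo ≤? x) ×-dec (x ≤? hi)) ×-dec (D <? g x)
    upward : ∀ {x y} → P x → x ≤ y → y ≤ hi → P y
    upward (x∈ , D<gx) x≤y y≤hi =
      let y∈ = ≤-trans (proj₁ x∈) x≤y , y≤hi in y∈ , <-≤-trans D<gx (mono x∈ y∈ x≤y)

  ¬preserves⇒witness : ∀ {g c d} → ¬ Preserves f g c d → ∃ λ x → x ∈[ c , d ] × g (f x) ≢ f (g x)
  ¬preserves⇒witness {g} {c} {d} ¬preserves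
    with anyUpTo? (λ x → ((c ≤? x) ×-dec (x ≤? d)) ×-dec ¬? (g (f x) ≟ f (g x))) (suc d)
  ... | yes (x , _ , x∈ , fails) = x , x∈ , fails
  ... | no ∄ = contradiction preserves ¬preserves
    where
    preserves : Preserves f g c d
    preserves x x∈ =
      decidable-stable (g (f x) ≟ f (g x)) λ fails → ∄ (x , s≤s (proj₂ x∈) , x∈ , fails)

module _ {f : ℕ → ℕ} (bf : BlockFunction f) {a b : ℕ → ℕ} {φ : ℕ → ℕ → ℕ} (W : WeakCoding f a b φ) where
  open WeakCoding W

  level-closed : ∀ i → Closed f (a i) (b i)
  level-closed i = contains-blocks⇒closed bf (block-cont i)

  Φ : ℕ → ℕ → ℕ → ℕ
  Φ i zero    x = x
  Φ i (suc k) x = φ (k + i) (Φ i k x)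

  Φ-∈ : ∀ {i k x} → x ∈[ a i , b i ] → Φ i k x ∈[ a (k + i) , b (k + i) ]
  Φ-∈ {k = zero}  x∈ = x∈
  Φ-∈ {k = suc k} x∈ = maps-into _ _ (Φ-∈ {k = k} x∈)

  Φ-inflating : ∀ {i k x} → x ∈[ a i , b i ] → x ≤ Φ i k x
  Φ-inflating {k = zero}  x∈ = ≤-refl
  Φ-inflating {k = suc k} x∈ = ≤-trans (Φ-inflating {k = k} x∈) (inflating _ _ (Φ-∈ {k = k} x∈))

  Φ-strictMono : ∀ {i k x y} → x ∈[ a i , b i ] → y ∈[ a i , b i ] → x < y → Φ i k x < Φ i k y
  Φ-strictMono {k = zero}  x∈ y∈ x<y = x<y
  Φ-strictMono {k = suc k} x∈ y∈ x<y =
    strict-mono _ _ _ (Φ-∈ {k = k} x∈) (Φ-∈ {k = k} y∈) (Φ-strictMono {k = k} x∈ y∈ x<y)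

  Φ-mono : ∀ {i k x y} → x ∈[ a i , b i ] → y ∈[ a i , b i ] → x ≤ y → Φ i k x ≤ Φ i k y
  Φ-mono {k = k} x∈ y∈ x≤y with m≤n⇒m<n∨m≡n x≤y
  ... | inj₁ x<y  = <⇒≤ (Φ-strictMono {k = k} x∈ y∈ x<y)
  ... | inj₂ refl = ≤-refl

  Φ-injective : ∀ {i k x y} → x ∈[ a i , b i ] → y ∈[ a i , b i ] → Φ i k x ≡ Φ i k y → x ≡ y
  Φ-injective {k = k} x∈ y∈ eq = ≤-antisym
    (≮⇒≥ λ y<x → <-irrefl (sym eq) (Φ-strictMono {k = k} y∈ x∈ y<x))
    (≮⇒≥ λ x<y → <-irrefl eq (Φ-strictMono {k = k} x∈ y∈ x<y))

  Φ-+ : ∀ {i} l m x → Φ i (l + m) x ≡ Φ (m + i) l (Φ i m x)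
  Φ-+     zero    m x = refl
  Φ-+ {i} (suc l) m x = cong₂ φ (+-assoc l m i) (Φ-+ l m x)

  Φ-suc : ∀ {i} k x → Φ i (suc k) x ≡ Φ (suc i) k (φ i x)
  Φ-suc {i} k x = trans (cong (λ n → Φ i n x) (+-comm 1 k)) (Φ-+ k 1 x)

  Φ-mono-length : ∀ {i k l x} → x ∈[ a i , b i ] → k ≤ l → Φ i k x ≤ Φ i l x
  Φ-mono-length {i} {k} {l} {x} x∈ k≤l = begin
    Φ i k x                      ≤⟨ Φ-inflating {k = l ∸ k} (Φ-∈ {k = k} x∈) ⟩
    Φ (k + i) (l ∸ k) (Φ i k x)  ≡⟨ Φ-+ (l ∸ k) k x ⟨
    Φ i (l ∸ k + k) x            ≡⟨ cong (λ n → Φ i n x) (m∸n+n≡m k≤l) ⟩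
    Φ i l x                      ∎
    where open ≤-Reasoning

  Φ-even-comm : ∀ {i k x} → Even k → x ∈[ a i , b i ] → Φ i k (f x) ≡ f (Φ i k x)
  Φ-even-comm zero x∈ = refl
  Φ-even-comm {i} {suc (suc k)} (2+ ek) x∈ =
    trans (cong (φ (suc (k + i)) ∘ φ (k + i)) (Φ-even-comm ek x∈)) (comp-pres (k + i) _ (Φ-∈ {k = k} x∈))

  Φ-+-comm : ∀ {i} l m {x} → Even (l + m) → x ∈[ a i , b i ]
           → Φ (m + i) l (Φ i m (f x)) ≡ f (Φ (m + i) l (Φ i m x))
  Φ-+-comm {i} l m {x} even x∈ = begin
    Φ (m + i) l (Φ i m (f x))  ≡⟨ Φ-+ l m (f x) ⟨
    Φ i (l + m) (f x)          ≡⟨ Φ-even-comm even x∈ ⟩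
    f (Φ i (l + m) x)          ≡⟨ cong f (Φ-+ l m x) ⟩
    f (Φ (m + i) l (Φ i m x))  ∎
    where open ≡-Reasoning

  Φ-odd-¬comm : ∀ {k x} → Even k → x ∈[ a 0 , b 0 ] → φ 0 (f x) ≢ f (φ 0 x)
              → Φ 0 (suc k) (f x) ≢ f (Φ 0 (suc k) x)
  Φ-odd-¬comm {k} {x} ek x∈ fails eq = fails (Φ-injective {k = k} φfx∈ fφx∈ tails-agree)
    where
    φx∈ : φ 0 x ∈[ a 1 , b 1 ]
    φx∈ = maps-into 0 x x∈
    φfx∈ : φ 0 (f x) ∈[ a 1 , b 1 ]
    φfx∈ = maps-into 0 (f x) (proj₁ (level-closed 0) x x∈)
    fφx∈ : f (φ 0 x) ∈[ a 1 , b 1 ]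
    fφx∈ = proj₁ (level-closed 1) (φ 0 x) φx∈
    tails-agree : Φ 1 k (φ 0 (f x)) ≡ Φ 1 k (f (φ 0 x))
    tails-agree = begin
      Φ 1 k (φ 0 (f x))  ≡⟨ Φ-suc k (f x) ⟨
      Φ 0 (suc k) (f x)  ≡⟨ eq ⟩
      f (Φ 0 (suc k) x)  ≡⟨ cong f (Φ-suc k x) ⟩
      f (Φ 1 k (φ 0 x))  ≡⟨ Φ-even-comm ek φx∈ ⟨
      Φ 1 k (f (φ 0 x))  ∎
      where open ≡-Reasoning

  Escapes : ℕ → ℕ → Set
  Escapes i x = ∀ D → ∃ λ j → D < Φ i j x

  failure-moves : ∀ {x} → x ∈[ a 0 , b 0 ] → φ 0 (f x) ≢ f (φ 0 x) → ∀ k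
    → Φ 0 (k + k) x + Φ 0 (k + k) (f x) < Φ 0 (suc k + suc k) x + Φ 0 (suc k + suc k) (f x)
  failure-moves {x} x∈ fails k = moves (m≤n⇒m<n∨m≡n (E≤O x∈)) (m≤n⇒m<n∨m≡n (E≤O fx∈))
    where
    E O E′ : ℕ → ℕ
    E  = Φ 0 (k + k)
    O  = Φ 0 (suc (k + k))
    E′ = Φ 0 (suc k + suc k)
    fx∈ : f x ∈[ a 0 , b 0 ]
    fx∈ = proj₁ (level-closed 0) x x∈
    E≤O : ∀ {y} → y ∈[ a 0 , b 0 ] → E y ≤ O y
    E≤O y∈ = Φ-mono-length y∈ (n≤1+n (k + k))
    O≤E′ : ∀ {y} → y ∈[ a 0 , b 0 ] → O y ≤ E′ y
    O≤E′ y∈ = Φ-mono-length y∈ (s≤s (+-monoʳ-≤ k (n≤1+n k)))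
    moves : E x < O x ⊎ E x ≡ O x → E (f x) < O (f x) ⊎ E (f x) ≡ O (f x)
          → E x + E (f x) < E′ x + E′ (f x)
    moves (inj₁ x-moves) _ =
      +-mono-<-≤ (<-≤-trans x-moves (O≤E′ x∈)) (≤-trans (E≤O fx∈) (O≤E′ fx∈))
    moves (inj₂ _) (inj₁ fx-moves) =
      +-mono-≤-< (≤-trans (E≤O x∈) (O≤E′ x∈)) (<-≤-trans fx-moves (O≤E′ fx∈))
    moves (inj₂ x-stays) (inj₂ fx-stays) = contradiction (begin
      O (f x)  ≡⟨ fx-stays ⟨
      E (f x)  ≡⟨ Φ-even-comm (even-double k) x∈ ⟩
      f (E x)  ≡⟨ cong f x-stays ⟩
      f (O x)  ∎) (Φ-odd-¬comm (even-double k) x∈ fails)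
      where open ≡-Reasoning

  failure-escapes : ∀ {x} → x ∈[ a 0 , b 0 ] → φ 0 (f x) ≢ f (φ 0 x) → Escapes 0 x
  failure-escapes {x} x∈ fails D with closed-prefix bf D
  ... | D′ , D≤D′ , (fw , _) = K + K , ≤-<-trans D≤D′ (≰⇒> EK≰D′)
    where
    E : ℕ → ℕ → ℕ
    E k = Φ 0 (k + k)
    K : ℕ
    K = suc (D′ + D′)
    EK≰D′ : ¬ E K x ≤ D′
    EK≰D′ EK≤D′ = <⇒≱ (n<1+n (D′ + D′)) (begin
      K                     ≤⟨ increasing⇒n≤ (failure-moves x∈ fails) K ⟩
      E K x + E K (f x)     ≡⟨ cong (E K x +_) (Φ-even-comm (even-double K) x∈) ⟩
      E K x + f (E K x)     ≤⟨ +-mono-≤ EK≤D′ (proj₂ (fw _ (z≤n , EK≤D′))) ⟩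
      D′ + D′               ∎)
      where open ≤-Reasoning

  escapes-Φ : ∀ {i m x} → x ∈[ a i , b i ] → Escapes i x → Escapes (m + i) (Φ i m x)
  escapes-Φ {i} {m} {x} x∈ escapes D = let (j , D<Φx) = escapes D in j , further j D<Φx
    where
    further : ∀ j → D < Φ i j x → D < Φ (m + i) j (Φ i m x)
    further j D<Φx = begin-strict
      D                      <⟨ D<Φx ⟩
      Φ i j x                ≤⟨ Φ-mono-length x∈ (m≤m+n j m) ⟩
      Φ i (j + m) x          ≡⟨ Φ-+ j m x ⟩
      Φ (m + i) j (Φ i m x)  ∎
      where open ≤-Reasoning

  hull-escapes : ∀ {i u v} (H : ClosedHull f u v) → let open ClosedHull H in
    u ≤ v → a i ≤ lo → hi ≤ b i → Escapes i u → Escapes i lo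
  hull-escapes {i} {u} H u≤v a≤lo hi≤b escapes E with closed-prefix bf E
  ... | E′ , E≤E′ , cE′ with escapes E′
  ...   | j , E′<Φu = j + j , ≤-<-trans E≤E′ (hull-above (Φ i (j + j)) H u≤v
      (λ x∈ y∈ → Φ-mono {k = j + j} (widen x∈) (widen y∈))
      (λ x∈ → Φ-even-comm (even-double j) (widen x∈))
      cE′ (<-≤-trans E′<Φu (Φ-mono-length (widen u∈) (m≤m+n j j))))
    where
    open ClosedHull H
    widen : ∀ {x} → x ∈[ lo , hi ] → x ∈[ a i , b i ]
    widen = ∈-widen a≤lo hi≤b
    u∈ : u ∈[ lo , hi ]
    u∈ = lo≤u , ≤-trans u≤v v≤hi

  record Stage : Set where
    field
      level lo hi : ℕ
      lo≤hi   : lo ≤ hi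
      a≤lo    : a level ≤ lo
      hi≤b    : hi ≤ b level
      closed  : Closed f lo hi
      escapes : Escapes level lo

    within : ∀ {x} → x ∈[ lo , hi ] → x ∈[ a level , b level ]
    within = ∈-widen a≤lo hi≤b

  hullStage : ∀ n {u v} → ClosedHull f u v → u ≤ v
    → u ∈[ a n , b n ] → v ∈[ a n , b n ] → Escapes n u → Stage
  hullStage n H u≤v u∈ v∈ escapes = record
    { level = n ; lo = lo ; hi = hi
    ; lo≤hi = ≤-trans lo≤u (≤-trans u≤v v≤hi)
    ; a≤lo = a≤lo ; hi≤b = hi≤b ; closed = closed
    ; escapes = hull-escapes H u≤v a≤lo hi≤b escapes
    }
    where
    open ClosedHull H
    a≤lo : a n ≤ lo
    a≤lo = proj₁ (minimal (proj₁ u∈) (proj₂ v∈) (level-closed n))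
    hi≤b : hi ≤ b n
    hi≤b = proj₂ (minimal (proj₁ u∈) (proj₂ v∈) (level-closed n))

  -- The jump is odd and long enough that Ψ lo lies beyond the closed prefix [0, bound] ∋ hi.
  module Step (s : Stage) where
    open Stage s

    lo∈ : lo ∈[ a level , b level ]
    lo∈ = within (≤-refl , lo≤hi)
    hi∈ : hi ∈[ a level , b level ]
    hi∈ = within (lo≤hi , ≤-refl)

    prefix : ∃ λ D → hi ≤ D × Closed f 0 D
    prefix = closed-prefix bf hi
    bound : ℕ
    bound = proj₁ prefix

    half : ℕ
    half = proj₁ (escapes bound)
    jump : ℕ
    jump = suc (half + half)

    Ψ : ℕ → ℕ
    Ψ = Φ level jump

    Ψ-mono : ∀ {x y} → x ∈[ lo , hi ] → y ∈[ lo , hi ] → x ≤ y → Ψ x ≤ Ψ y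
    Ψ-mono x∈ y∈ = Φ-mono {k = jump} (within x∈) (within y∈)
    Ψlo≤Ψhi : Ψ lo ≤ Ψ hi
    Ψlo≤Ψhi = Φ-mono lo∈ hi∈ lo≤hi

    image-hull : ClosedHull f (Ψ lo) (Ψ hi)
    image-hull = closedHull bf (Ψ lo) (Ψ hi)
    open ClosedHull image-hull using (lo≤u; v≤hi)

    next : Stage
    next = hullStage (jump + level) image-hull Ψlo≤Ψhi (Φ-∈ lo∈) (Φ-∈ hi∈) (escapes-Φ lo∈ escapes)

    Ψ-∈ : ∀ {x} → x ∈[ lo , hi ] → Ψ x ∈[ Stage.lo next , Stage.hi next ]
    Ψ-∈ x∈@(lo≤x , x≤hi) =
      ≤-trans lo≤u (Ψ-mono (≤-refl , lo≤hi) x∈ lo≤x) , ≤-trans (Ψ-mono x∈ (lo≤hi , ≤-refl) x≤hi) v≤hi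

    bound<Ψlo : bound < Ψ lo
    bound<Ψlo = <-≤-trans (proj₂ (escapes bound)) (Φ-mono-length lo∈ (m≤n+m half (suc half)))

    separated : hi < Stage.lo next
    separated = ≤-<-trans (proj₁ (proj₂ prefix))
      (hull-above id image-hull Ψlo≤Ψhi (λ _ _ → id) (λ _ → refl) (proj₂ (proj₂ prefix)) bound<Ψlo)

  module Construction {x₀} (x₀∈ : x₀ ∈[ a 0 , b 0 ]) (fails : φ 0 (f x₀) ≢ f (φ 0 x₀)) where

    block₀ : ClosedHull f x₀ x₀
    block₀ = closedHull bf x₀ x₀

    stages : ℕ → Stage
    stages zero    = hullStage 0 block₀ ≤-refl x₀∈ x₀∈ (failure-escapes x₀∈ fails)
    stages (suc k) = Step.next (stages k)

    A B : ℕ → ℕ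
    A k = Stage.lo (stages k)
    B k = Stage.hi (stages k)

    Ψ : ℕ → ℕ → ℕ
    Ψ k = Step.Ψ (stages k)

    consecutive-jumps-even : ∀ k → Even (Step.jump (stages (suc k)) + Step.jump (stages k))
    consecutive-jumps-even k =
      even-suc+suc (even-double (Step.half (stages (suc k)))) (even-double (Step.half (stages k)))

    weakCoding : WeakCoding f A B Ψ
    weakCoding = record
      { maps-into   = λ k _ → Step.Ψ-∈ (stages k)
      ; block-cont  = λ k _ x∈ _ _ (_ , _ , minimal) → minimal (A k) (B k) x∈ (Stage.closed (stages k))
      ; strict-mono = λ k _ _ x∈ y∈ →
                        Φ-strictMono (Stage.within (stages k) x∈) (Stage.within (stages k) y∈)
      ; inflating   = λ k _ x∈ → Φ-inflating (Stage.within (stages k) x∈)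
      ; comp-pres   = λ k _ x∈ → Φ-+-comm (Step.jump (stages (suc k))) (Step.jump (stages k))
                        (consecutive-jumps-even k) (Stage.within (stages k) x∈)
      ; first-not   = λ preserves → Φ-odd-¬comm (even-double (Step.half (stages 0))) x₀∈ fails
                        (preserves x₀ (ClosedHull.lo≤u block₀ , ClosedHull.v≤hi block₀))
      }

    separated : ∀ k → B k < A (suc k)
    separated k = Step.separated (stages k)

lemma3p5 : (f : ℕ → ℕ) → BlockFunction f
    → Σ (ℕ → ℕ) (λ a → Σ (ℕ → ℕ) (λ b → Σ (ℕ → ℕ → ℕ) (λ φ → WeakCoding f a b φ)))
    → Σ (ℕ → ℕ) (λ a → Σ (ℕ → ℕ) (λ b → Σ (ℕ → ℕ → ℕ) (λ φ → Coding f a b φ)))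
lemma3p5 f bf (a , b , φ , W) with ¬preserves⇒witness {f = f} {g = φ 0} (WeakCoding.first-not W)
... | x₀ , x₀∈ , fails = A , B , Ψ , record { weak = weakCoding ; separated = separated }
  where open Construction bf W x₀∈ fails
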